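{- For an integer $k\ge 1$ let $n=2^k$, let $T_k$ be the complete binary tree with $2^k$ leaves, and let $S_n$ be the tree obtained from $T_k$ and a star with $n$ leaves by adding an edge between the root of $T_k$ and the center of the star. Then there is a constant $c>0$ (independent of $n$) such that every rectangular layout of $S_n$ on the integer grid has area at least $c\, n\log n$.
   Context: A (strong) rectangular layout of a graph is a set of axis-parallel rectangles with pairwise disjoint interiors, one per vertex, such that two rectangles' boundaries share a segment of positive length if and only if the corresponding vertices are adjacent. On the integer grid all corners have integer coordinates; the area is that of the smallest enclosing axis-parallel bounding box. -}

module Defs where

open import Data.Nat as ℕ using (ℕ; suc; _^_)
open import Data.Integer as ℤ using (ℤ; _<_; _≤_; _-_; _*_)
open import Data.Fin using (Fin; toℕ)
open import Data.Product using (_×_; Σ)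
open import Data.Sum using (_⊎_)
open import Relation.Binary.PropositionalEquality using (_≡_; _≢_)
open import Function.Bundles using (_⇔_)

-- Vertices are 0 .. 3·2^k - 1 (as Fin (3 * 2 ^ k)):
--   0                         : centre of the star
--   1 .. 2^(k+1) - 1          : nodes of the complete binary tree T_k in
--                               heap order (root 1, children of i are 2i, 2i+1;
--                               the leaves are 2^k .. 2^(k+1) - 1)
--   2^(k+1) .. 3·2^k - 1      : the n = 2^k leaves of the star

data Arc (k : ℕ) : ℕ → ℕ → Set where
  tree-left   : ∀ i → 1 ℕ.≤ i → 2 ℕ.* i ℕ.< 2 ^ suc k → Arc k i (2 ℕ.* i)
  tree-right  : ∀ i → 1 ℕ.≤ i → 2 ℕ.* i ℕ.+ 1 ℕ.< 2 ^ suc k → Arc k i (2 ℕ.* i ℕ.+ 1)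
  root-centre : Arc k 0 1
  star        : ∀ j → 2 ^ suc k ℕ.≤ j → j ℕ.< 3 ℕ.* 2 ^ k → Arc k 0 j

∣S∣ : ℕ → ℕ
∣S∣ k = 3 ℕ.* 2 ^ k

SAdj : (k : ℕ) → Fin (∣S∣ k) → Fin (∣S∣ k) → Set
SAdj k u v = Arc k (toℕ u) (toℕ v) ⊎ Arc k (toℕ v) (toℕ u)

record Rect : Set where
  field
    x₁ x₂ y₁ y₂ : ℤ
    x₁<x₂ : x₁ < x₂
    y₁<y₂ : y₁ < y₂
open Rect public

-- Open intervals (a,b) and (c,d) intersect (overlap with positive length).
Overlap : ℤ → ℤ → ℤ → ℤ → Set
Overlap a b c d = (a < d) × (c < b)

InteriorsDisjoint : Rect → Rect → Set
InteriorsDisjoint r s = Overlap (x₁ r) (x₂ r) (x₁ s) (x₂ s) → Overlap (y₁ r) (y₂ r) (y₁ s) (y₂ s) → Data.Empty.⊥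
  where import Data.Empty

VSide : Rect → ℤ → Set
VSide r x = (x ≡ x₁ r) ⊎ (x ≡ x₂ r)

HSide : Rect → ℤ → Set
HSide r y = (y ≡ y₁ r) ⊎ (y ≡ y₂ r)

-- The boundaries of r and s share a segment of positive length.
-- (Any segment on the boundary of a rectangle lies on one of its sides,
-- so a shared segment is either vertical on a common vertical side line with
-- overlapping y-ranges, or horizontal analogously.)
ShareSegment : Rect → Rect → Set
ShareSegment r s =
    (Σ ℤ λ x → VSide r x × VSide s x × Overlap (y₁ r) (y₂ r) (y₁ s) (y₂ s))
  ⊎ (Σ ℤ λ y → HSide r y × HSide s y × Overlap (x₁ r) (x₂ r) (x₁ s) (x₂ s))

record RectLayout (N : ℕ) (Adj : Fin N → Fin N → Set) : Set₁ where
  field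
    rect     : Fin N → Rect
    disjoint : ∀ u v → u ≢ v → InteriorsDisjoint (rect u) (rect v)
    contact  : ∀ u v → u ≢ v → ShareSegment (rect u) (rect v) ⇔ Adj u v
open RectLayout public

Encloses : ∀ {N Adj} → RectLayout N Adj → ℤ → ℤ → ℤ → ℤ → Set
Encloses L X₁ X₂ Y₁ Y₂ = ∀ v →
  (X₁ ≤ x₁ (rect L v)) × (x₂ (rect L v) ≤ X₂) × (Y₁ ≤ y₁ (rect L v)) × (y₂ (rect L v) ≤ Y₂)

-- The centre of the star touches all n = 2^k leaves of the star; each contact contains a
-- unit segment of the centre's boundary, and leaves with disjoint interiors use different
-- unit segments, so n ≤ 2(w + h) ≤ 2(W + H) for the centre's sides w, h and the bounding
-- box's sides W, H.
--
-- Some vertical line crosses ⌊k/2⌋ + 1 rectangles of the complete binary tree T_k.  By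
-- induction, take such lines ℓ₁, ℓ₂, ℓ₃ for the three grandchild subtrees 00, 01, 10 of the
-- root.  The tree path from the root to a crossed rectangle of subtree j avoids subtree i
-- and consists of rectangles whose x-ranges touch, so either one of them crosses ℓᵢ and can
-- be added, or that crossed rectangle lies on the same side of ℓᵢ as the root.  If no line
-- can be extended, two of them, ℓᵢ and ℓⱼ, see the other subtrees on the same side, say
-- the left, and the crossed rectangles rᵢ, rⱼ give ℓᵢ < right(rᵢ) ≤ ℓⱼ < right(rⱼ) ≤ ℓᵢ.
-- Rectangles crossed by one line have disjoint y-ranges, so H ≥ ⌊k/2⌋ + 1, and likewise
-- W ≥ ⌊k/2⌋ + 1 after transposing the layout.  Hence n·k ≤ 2(W + H)·2(⌊k/2⌋ + 1) ≤ 8WH.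

{-# OPTIONS --safe #-}
module Submission where

open import Defs

open import Data.Bool using (Bool; false; true)
open import Data.Empty using (⊥; ⊥-elim)
open import Data.Fin using (Fin; zero; suc; toℕ; fromℕ<)
open import Data.Fin.Properties using (toℕ-fromℕ<; toℕ-injective; toℕ<n; injective⇒≤; +↔⊎; _≟_)
open import Data.Integer using (ℤ; +_; -_; ∣_∣; _≤_; _<_; _-_; _*_; _≤?_; _<?_; +≤+)
import Data.Integer.Properties as ℤₚ
open import Algebra.Properties.AbelianGroup ℤₚ.+-0-abelianGroup using (∙-cancelʳ)
open import Data.List using (List; []; _∷_; _∷ʳ_; length; reverse)
open import Data.List.Properties using (reverse-++; reverse-injective; length-reverse; ∷-injectiveʳ)
open import Data.List.Relation.Binary.Prefix.Heterogeneous using (Prefix; []; _∷_)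
open import Data.List.Relation.Binary.Prefix.Heterogeneous.Properties using (length-mono)
open import Data.Nat using (ℕ; zero; suc; _^_; ⌊_/2⌋; z≤n; s≤s; NonZero; _≥_)
import Data.Nat as ℕ
open import Data.Nat.DivMod using (_mod_; m<n⇒m%n≡m)
import Data.Nat.Properties as ℕₚ
open import Data.Nat.Tactic.RingSolver using (solve-∀)
open import Data.Product using (Σ; _×_; _,_; proj₁; proj₂)
open import Data.Sum as Sum using (_⊎_; inj₁; inj₂)
open import Data.Sum.Function.Propositional using (_⊎-↣_)
open import Data.Sum.Properties using (inj₁-injective; inj₂-injective)
open import Function using (_∘_; id; flip; Injective; _↣_; Injection; Equivalence; mk⇔)
open import Function.Construct.Composition using (_↣-∘_)
open import Function.Properties.Inverse using (↔⇒↣; ↔-sym)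
open import Relation.Binary.PropositionalEquality
  using (_≡_; _≢_; refl; sym; trans; cong; cong₂; subst; subst₂)
open import Relation.Nullary using (yes; no)

-- Unit cells of an integer interval

Within : ℤ → ℤ → ℤ → Set
Within p a b = a ≤ p × p < b

within⇒Overlap : ∀ {p a b c d} → Within p a b → Within p c d → Overlap a b c d
within⇒Overlap (a≤p , p<b) (c≤p , p<d) = ℤₚ.≤-<-trans a≤p p<d , ℤₚ.≤-<-trans c≤p p<b

Overlap⇒common-cell : ∀ {a b c d} → a < b → c < d → Overlap a b c d →
                      Σ ℤ λ p → Within p a b × Within p c d
Overlap⇒common-cell {a} {c = c} a<b c<d (a<d , c<b) with a ≤? c
... | yes a≤c = c , (a≤c , c<b) , (ℤₚ.≤-refl , c<d)
... | no a≰c  = a , (ℤₚ.≤-refl , a<b) , (ℤₚ.<⇒≤ (ℤₚ.≰⇒> a≰c) , a<d)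

same-start⇒Overlap : ∀ {a b c d} → a ≡ c → a < b → c < d → Overlap a b c d
same-start⇒Overlap refl a<b c<d = c<d , a<b

same-end⇒Overlap : ∀ {a b c d} → b ≡ d → a < b → c < d → Overlap a b c d
same-end⇒Overlap refl a<b c<d = a<b , c<d

∣lo-a∣<∣lo-b∣ : ∀ {lo a b} → lo ≤ a → a < b → ∣ lo - a ∣ ℕ.< ∣ lo - b ∣
∣lo-a∣<∣lo-b∣ {lo} lo≤a a<b = ℤₚ.drop‿+<+ (subst₂ _<_
  (sym (ℤₚ.∣-∣-≤ lo≤a)) (sym (ℤₚ.∣-∣-≤ (ℤₚ.<⇒≤ (ℤₚ.≤-<-trans lo≤a a<b))))
  (ℤₚ.+-monoˡ-< (- lo) a<b))

∣lo-a∣-injective : ∀ {lo a b} → lo ≤ a → lo ≤ b → ∣ lo - a ∣ ≡ ∣ lo - b ∣ → a ≡ b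
∣lo-a∣-injective {lo} lo≤a lo≤b eq =
  ∙-cancelʳ (- lo) _ _ (trans (sym (ℤₚ.∣-∣-≤ lo≤a)) (trans (cong +_ eq) (ℤₚ.∣-∣-≤ lo≤b)))

∣a-b∣≤∣lo-hi∣ : ∀ {lo a b hi} → lo ≤ a → a ≤ b → b ≤ hi → ∣ a - b ∣ ℕ.≤ ∣ lo - hi ∣
∣a-b∣≤∣lo-hi∣ lo≤a a≤b b≤hi = ℤₚ.drop‿+≤+ (subst₂ _≤_
  (sym (ℤₚ.∣-∣-≤ a≤b)) (sym (ℤₚ.∣-∣-≤ (ℤₚ.≤-trans lo≤a (ℤₚ.≤-trans a≤b b≤hi))))
  (ℤₚ.+-mono-≤ b≤hi (ℤₚ.neg-mono-≤ lo≤a)))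

cell : ∀ {lo p hi} → Within p lo hi → Fin ∣ lo - hi ∣
cell (lo≤p , p<hi) = fromℕ< (∣lo-a∣<∣lo-b∣ lo≤p p<hi)

cell-injective : ∀ {lo p q hi} (p∈ : Within p lo hi) (q∈ : Within q lo hi) →
                 cell p∈ ≡ cell q∈ → p ≡ q
cell-injective (lo≤p , _) (lo≤q , _) eq = ∣lo-a∣-injective lo≤p lo≤q
  (trans (sym (toℕ-fromℕ< _)) (trans (cong toℕ eq) (toℕ-fromℕ< _)))

injective-into-interval : ∀ {n lo hi} (f : Fin n → ℤ) → Injective _≡_ _≡_ f →
                          (∀ i → Within (f i) lo hi) → n ℕ.≤ ∣ lo - hi ∣
injective-into-interval f f-injective f∈ =
  injective⇒≤ {f = cell ∘ f∈} (f-injective ∘ cell-injective (f∈ _) (f∈ _))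

-- Rectangles and vertical lines

width height : Rect → ℕ
width r = ∣ x₁ r - x₂ r ∣
height r = ∣ y₁ r - y₂ r ∣

transpose : Rect → Rect
transpose r = record
  { x₁ = y₁ r ; x₂ = y₂ r ; y₁ = x₁ r ; y₂ = x₂ r ; x₁<x₂ = y₁<y₂ r ; y₁<y₂ = x₁<x₂ r }

transpose-layout : ∀ {N Adj} → RectLayout N Adj → RectLayout N Adj
transpose-layout L = record
  { rect     = transpose ∘ rect L
  ; disjoint = λ u v u≢v → flip (disjoint L u v u≢v)
  ; contact  = λ u v u≢v → let open Equivalence (contact L u v u≢v) in
                 mk⇔ (to ∘ Sum.swap) (Sum.swap ∘ from)
  }

-- The vertical line x = c + ½ crosses r.
Meets : ℤ → Rect → Set
Meets c r = Within c (x₁ r) (x₂ r)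

data Side : Set where
  left right : Side

data Beside : Side → ℤ → Rect → Set where
  left-of  : ∀ {c r} → x₂ r ≤ c → Beside left c r
  right-of : ∀ {c r} → c < x₁ r → Beside right c r

BothBeside : ℤ → Rect → Rect → Set
BothBeside c r s = Σ Side λ σ → Beside σ c r × Beside σ c s

meets-or-beside : ∀ c r → Meets c r ⊎ Σ Side λ σ → Beside σ c r
meets-or-beside c r with x₁ r ≤? c | c <? x₂ r
... | yes x₁≤c | yes c<x₂ = inj₁ (x₁≤c , c<x₂)
... | yes _    | no c≮x₂  = inj₂ (left , left-of (ℤₚ.≮⇒≥ c≮x₂))
... | no x₁≰c  | _        = inj₂ (right , right-of (ℤₚ.≰⇒> x₁≰c))

XIntersect : Rect → Rect → Set
XIntersect r s = x₁ s ≤ x₂ r × x₁ r ≤ x₂ s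

ShareSegment⇒XIntersect : ∀ {r s} → ShareSegment r s → XIntersect r s
ShareSegment⇒XIntersect {r} {s} (inj₁ (x , x∈r , x∈s , _)) =
  ℤₚ.≤-trans (proj₁ (on-vside s x∈s)) (proj₂ (on-vside r x∈r)) ,
  ℤₚ.≤-trans (proj₁ (on-vside r x∈r)) (proj₂ (on-vside s x∈s))
  where
  on-vside : ∀ t {x} → VSide t x → x₁ t ≤ x × x ≤ x₂ t
  on-vside t (inj₁ refl) = ℤₚ.≤-refl , ℤₚ.<⇒≤ (x₁<x₂ t)
  on-vside t (inj₂ refl) = ℤₚ.<⇒≤ (x₁<x₂ t) , ℤₚ.≤-refl
ShareSegment⇒XIntersect (inj₂ (_ , _ , _ , x₁r<x₂s , x₁s<x₂r)) = ℤₚ.<⇒≤ x₁s<x₂r , ℤₚ.<⇒≤ x₁r<x₂s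

beside-step : ∀ {σ c r s} → XIntersect r s → Beside σ c r → Meets c s ⊎ Beside σ c s
beside-step {c = c} {s = s} r∩s r-beside with meets-or-beside c s | r-beside
... | inj₁ s-meets             | _ = inj₁ s-meets
... | inj₂ (left , s-left)     | left-of _  = inj₂ s-left
... | inj₂ (right , s-right)   | right-of _ = inj₂ s-right
... | inj₂ (right , right-of c<x₁s) | left-of x₂r≤c =
  ⊥-elim (ℤₚ.<-irrefl refl (ℤₚ.<-≤-trans c<x₁s (ℤₚ.≤-trans (proj₁ r∩s) x₂r≤c)))
... | inj₂ (left , left-of x₂s≤c)   | right-of c<x₁r =
  ⊥-elim (ℤₚ.<-irrefl refl (ℤₚ.<-≤-trans c<x₁r (ℤₚ.≤-trans (proj₂ r∩s) x₂s≤c)))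

crossing : ∀ {σ c c′ r r′} → Meets c r → Meets c′ r′ → Beside σ c r′ → Beside σ c′ r → ⊥
crossing {c = c} {c′} {r} {r′} (_ , c<x₂r) (_ , c′<x₂r′) (left-of x₂r′≤c) (left-of x₂r≤c′) =
  ℤₚ.<-irrefl refl (begin-strict
    c      <⟨ c<x₂r ⟩
    x₂ r   ≤⟨ x₂r≤c′ ⟩
    c′     <⟨ c′<x₂r′ ⟩
    x₂ r′  ≤⟨ x₂r′≤c ⟩
    c      ∎)
  where open ℤₚ.≤-Reasoning
crossing {c = c} {c′} {r} {r′} (x₁r≤c , _) (x₁r′≤c′ , _) (right-of c<x₁r′) (right-of c′<x₁r) =
  ℤₚ.<-irrefl refl (begin-strict
    x₁ r   ≤⟨ x₁r≤c ⟩
    c      <⟨ c<x₁r′ ⟩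
    x₁ r′  ≤⟨ x₁r′≤c′ ⟩
    c′     <⟨ c′<x₁r ⟩
    x₁ r   ∎)
  where open ℤₚ.≤-Reasoning

three-lines : ∀ {c₁ c₂ c₃ r₁ r₂ r₃} → Meets c₁ r₁ → Meets c₂ r₂ → Meets c₃ r₃ →
              BothBeside c₁ r₂ r₃ → BothBeside c₂ r₁ r₃ → BothBeside c₃ r₁ r₂ → ⊥
three-lines m₁ m₂ m₃ (left  , b₁₂ , _) (left  , b₂₁ , _) _ = crossing m₁ m₂ b₁₂ b₂₁
three-lines m₁ m₂ m₃ (right , b₁₂ , _) (right , b₂₁ , _) _ = crossing m₁ m₂ b₁₂ b₂₁
three-lines m₁ m₂ m₃ (left  , _ , b₁₃) (right , _ , _) (left  , b₃₁ , _) = crossing m₁ m₃ b₁₃ b₃₁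
three-lines m₁ m₂ m₃ (right , _ , b₁₃) (left  , _ , _) (right , b₃₁ , _) = crossing m₁ m₃ b₁₃ b₃₁
three-lines m₁ m₂ m₃ (left  , _ , _) (right , _ , b₂₃) (right , _ , b₃₂) = crossing m₂ m₃ b₂₃ b₃₂
three-lines m₁ m₂ m₃ (right , _ , _) (left  , _ , b₂₃) (left  , _ , b₃₂) = crossing m₂ m₃ b₂₃ b₃₂

data Chain {A : Set} (R : A → Rect) (P : A → Set) : A → A → Set where
  [_]    : ∀ {u} → P u → Chain R P u u
  _∷⟨_⟩_ : ∀ {u u′ v} → P u → XIntersect (R u) (R u′) → Chain R P u′ v → Chain R P u v

infixr 5 _∷⟨_⟩_

chain-start : ∀ {A R P} {u v : A} → Chain R P u v → P u
chain-start [ p ]         = p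
chain-start (p ∷⟨ _ ⟩ _) = p

chain-map : ∀ {A B : Set} {R : B → Rect} {P : A → Set} {Q : B → Set} (f : A → B) →
            (∀ {a} → P a → Q (f a)) → ∀ {u v} → Chain (R ∘ f) P u v → Chain R Q (f u) (f v)
chain-map f g [ p ]         = [ g p ]
chain-map f g (p ∷⟨ t ⟩ w) = g p ∷⟨ t ⟩ chain-map f g w

chain-meets-or-beside : ∀ {A R P σ c} {u v : A} → Chain R P u v → Beside σ c (R u) →
                        (Σ A λ z → P z × Meets c (R z)) ⊎ Beside σ c (R v)
chain-meets-or-beside [ _ ]         u-beside = inj₂ u-beside
chain-meets-or-beside (_ ∷⟨ t ⟩ w) u-beside with beside-step t u-beside
... | inj₁ u′-meets  = inj₁ (_ , chain-start w , u′-meets)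
... | inj₂ u′-beside = chain-meets-or-beside w u′-beside

-- Vertical lines stabbing a complete binary tree

Path : Set
Path = List Bool

record Stabbing (R : Path → Rect) (h m : ℕ) : Set where
  field
    line           : ℤ
    node           : Fin m → Path
    node-injective : Injective _≡_ _≡_ node
    node-depth     : ∀ i → length (node i) ℕ.≤ h
    stabs          : ∀ i → Meets line (R (node i))
open Stabbing

Fresh : ∀ {R h m} → Stabbing R h m → Path → Set
Fresh {h = h} K z = length z ℕ.≤ h × (∀ i → z ≢ node K i)

root-stabbing : ∀ {R h} → Stabbing R h 1
root-stabbing {R} = record
  { line           = x₁ (R [])
  ; node           = λ _ → []
  ; node-injective = λ { {zero} {zero} _ → refl }
  ; node-depth     = λ _ → z≤n
  ; stabs          = λ _ → ℤₚ.≤-refl , x₁<x₂ (R [])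
  }

extend : ∀ {R h m z} (K : Stabbing R h m) → Fresh K z → Meets (line K) (R z) →
         Stabbing R h (suc m)
extend {R} {h} {m} {z} K (z-depth , z-fresh) z-meets = record
  { line           = line K
  ; node           = node′
  ; node-injective = node′-injective
  ; node-depth     = λ { zero → z-depth ; (suc i) → node-depth K i }
  ; stabs          = λ { zero → z-meets ; (suc i) → stabs K i }
  }
  where
  node′ : Fin (suc m) → Path
  node′ zero    = z
  node′ (suc i) = node K i
  node′-injective : Injective _≡_ _≡_ node′
  node′-injective {zero}  {zero}  _  = refl
  node′-injective {zero}  {suc j} eq = ⊥-elim (z-fresh j eq)
  node′-injective {suc i} {zero}  eq = ⊥-elim (z-fresh i (sym eq))
  node′-injective {suc i} {suc j} eq = cong suc (node-injective K eq)

branch : ∀ {R h m v r r′} (K : Stabbing R h m) →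
         Chain R (Fresh K) v r → Chain R (Fresh K) v r′ →
         Stabbing R h (suc m) ⊎ BothBeside (line K) (R r) (R r′)
branch {R} {v = v} K w w′ with meets-or-beside (line K) (R v)
... | inj₁ v-meets = inj₁ (extend K (chain-start w) v-meets)
... | inj₂ (σ , v-beside)
  with chain-meets-or-beside w v-beside | chain-meets-or-beside w′ v-beside
...   | inj₁ (_ , z-fresh , z-meets) | _ = inj₁ (extend K z-fresh z-meets)
...   | inj₂ _ | inj₁ (_ , z-fresh , z-meets) = inj₁ (extend K z-fresh z-meets)
...   | inj₂ r-beside | inj₂ r′-beside = inj₂ (σ , r-beside , r′-beside)

record EdgesXIntersect (h : ℕ) (R : Path → Rect) : Set where
  constructor edges-x-intersect
  field
    edge : ∀ a β → length a ℕ.< h → XIntersect (R a) (R (a ∷ʳ β))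
open EdgesXIntersect

subtree : ∀ {h R} → EdgesXIntersect (suc h) R → ∀ β → EdgesXIntersect h (R ∘ (β ∷_))
subtree E β = edges-x-intersect λ a γ a<h → edge E (β ∷ a) γ (s≤s a<h)

_⊑_ : Path → Path → Set
_⊑_ = Prefix _≡_

infix 4 _⊑_

descend : ∀ {h R} → EdgesXIntersect h R → ∀ x → length x ℕ.≤ h → Chain R (_⊑ x) [] x
descend E []      _ = [ [] ]
descend {suc h} E (β ∷ x) (s≤s x≤h) =
  [] ∷⟨ edge E [] β (s≤s z≤n) ⟩
  chain-map (β ∷_) (λ a⊑x → refl ∷ a⊑x) (descend (subtree E β) x x≤h)

module _ {h R} (E : EdgesXIntersect (2 ℕ.+ h) R) where

  under : ∀ {m} β₁ β₂ → Stabbing (λ p → R (β₁ ∷ β₂ ∷ p)) h m → Stabbing R (2 ℕ.+ h) m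
  under β₁ β₂ K = record
    { line           = line K
    ; node           = λ i → β₁ ∷ β₂ ∷ node K i
    ; node-injective = node-injective K ∘ ∷-injectiveʳ ∘ ∷-injectiveʳ
    ; node-depth     = s≤s ∘ s≤s ∘ node-depth K
    ; stabs          = stabs K
    }

  route : ∀ {β₁ β₂ γ₁ γ₂ m m′} (K : Stabbing (λ p → R (β₁ ∷ β₂ ∷ p)) h m)
          (K′ : Stabbing (λ p → R (γ₁ ∷ γ₂ ∷ p)) h (suc m′)) → (β₁ , β₂) ≢ (γ₁ , γ₂) →
          Chain R (Fresh (under β₁ β₂ K)) [] (γ₁ ∷ γ₂ ∷ node K′ zero)
  route {β₁} {β₂} {γ₁} {γ₂} K K′ β≢γ =
    chain-map id fresh (descend E (γ₁ ∷ γ₂ ∷ node K′ zero) target-depth)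
    where
    target-depth : length (γ₁ ∷ γ₂ ∷ node K′ zero) ℕ.≤ 2 ℕ.+ h
    target-depth = s≤s (s≤s (node-depth K′ zero))
    same-grandchild : ∀ {y y′} → β₁ ∷ β₂ ∷ y ⊑ γ₁ ∷ γ₂ ∷ y′ → (β₁ , β₂) ≡ (γ₁ , γ₂)
    same-grandchild (refl ∷ refl ∷ _) = refl
    fresh : ∀ {z} → z ⊑ γ₁ ∷ γ₂ ∷ node K′ zero → Fresh (under β₁ β₂ K) z
    fresh z⊑ = ℕₚ.≤-trans (length-mono z⊑) target-depth ,
               λ _ z≡ → β≢γ (same-grandchild (subst (_⊑ _) z≡ z⊑))

  stabbing-step : ∀ {m} → Stabbing (λ p → R (false ∷ false ∷ p)) h (suc m) →
                  Stabbing (λ p → R (false ∷ true ∷ p)) h (suc m) →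
                  Stabbing (λ p → R (true ∷ false ∷ p)) h (suc m) →
                  Stabbing R (2 ℕ.+ h) (2 ℕ.+ m)
  stabbing-step K₁ K₂ K₃
    with branch (under false false K₁) (route K₁ K₂ λ ()) (route K₁ K₃ λ ())
       | branch (under false true K₂) (route K₂ K₁ λ ()) (route K₂ K₃ λ ())
       | branch (under true false K₃) (route K₃ K₁ λ ()) (route K₃ K₂ λ ())
  ... | inj₁ S | _      | _      = S
  ... | inj₂ _ | inj₁ S | _      = S
  ... | inj₂ _ | inj₂ _ | inj₁ S = S
  ... | inj₂ s₁ | inj₂ s₂ | inj₂ s₃ =
    ⊥-elim (three-lines (stabs K₁ zero) (stabs K₂ zero) (stabs K₃ zero) s₁ s₂ s₃)

stabbing : ∀ h {R} → EdgesXIntersect h R → Stabbing R h (suc ⌊ h /2⌋)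
stabbing zero          E = root-stabbing
stabbing (suc zero)    E = root-stabbing
stabbing (suc (suc h)) {R} E = stabbing-step E
  (stabbing h (grandchild false false)) (stabbing h (grandchild false true))
  (stabbing h (grandchild true false))
  where
  grandchild : ∀ β₁ β₂ → EdgesXIntersect h (λ p → R (β₁ ∷ β₂ ∷ p))
  grandchild β₁ β₂ = subtree (subtree E β₁) β₂

stabbed-y₁-distinct : ∀ {c r s} → Meets c r → Meets c s → InteriorsDisjoint r s → y₁ r ≢ y₁ s
stabbed-y₁-distinct {r = r} {s} c∈r c∈s r∩s=∅ y₁≡ =
  r∩s=∅ (within⇒Overlap c∈r c∈s) (same-start⇒Overlap y₁≡ (y₁<y₂ r) (y₁<y₂ s))

stabbing-height : ∀ {R h m lo hi} (K : Stabbing R h m) →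
  (∀ {a a′} → length a ℕ.≤ h → length a′ ℕ.≤ h → a ≢ a′ → InteriorsDisjoint (R a) (R a′)) →
  (∀ a → length a ℕ.≤ h → lo ≤ y₁ (R a) × y₂ (R a) ≤ hi) →
  m ℕ.≤ ∣ lo - hi ∣
stabbing-height {R} {lo = lo} {hi} K disjoint-nodes bounded =
  injective-into-interval (y₁ ∘ R ∘ node K) y₁-injective y₁∈
  where
  y₁∈ : ∀ i → Within (y₁ (R (node K i))) lo hi
  y₁∈ i = let (lo≤y₁ , y₂≤hi) = bounded _ (node-depth K i) in
          lo≤y₁ , ℤₚ.<-≤-trans (y₁<y₂ (R (node K i))) y₂≤hi
  y₁-injective : Injective _≡_ _≡_ (y₁ ∘ R ∘ node K)
  y₁-injective {i} {j} eq with i ≟ j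
  ... | yes i≡j = i≡j
  ... | no i≢j  = ⊥-elim (stabbed-y₁-distinct {r = R (node K i)} {R (node K j)}
                    (stabs K i) (stabs K j)
                    (disjoint-nodes (node-depth K i) (node-depth K j) (i≢j ∘ node-injective K)) eq)

-- Rectangles touching a common rectangle

data HContact (r s : Rect) : Set where
  above : ∀ p → Within p (x₁ r) (x₂ r) → Within p (x₁ s) (x₂ s) → y₁ s ≡ y₂ r → HContact r s
  below : ∀ p → Within p (x₁ r) (x₂ r) → Within p (x₁ s) (x₂ s) → y₂ s ≡ y₁ r → HContact r s

-- A contact along vertical sides is a horizontal contact of the transposed rectangles.
Contact : Rect → Rect → Set
Contact r s = HContact r s ⊎ HContact (transpose r) (transpose s)

horizontal-contact : ∀ {r s} →
  (Σ ℤ λ y → HSide r y × HSide s y × Overlap (x₁ r) (x₂ r) (x₁ s) (x₂ s)) →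
  InteriorsDisjoint r s → HContact r s
horizontal-contact {r} {s} (_ , y∈r , y∈s , x-overlap) r∩s=∅
  with Overlap⇒common-cell (x₁<x₂ r) (x₁<x₂ s) x-overlap | y∈r | y∈s
... | _ | inj₁ refl | inj₁ y₁≡ =
  ⊥-elim (r∩s=∅ x-overlap (same-start⇒Overlap y₁≡ (y₁<y₂ r) (y₁<y₂ s)))
... | _ | inj₂ refl | inj₂ y₂≡ =
  ⊥-elim (r∩s=∅ x-overlap (same-end⇒Overlap y₂≡ (y₁<y₂ r) (y₁<y₂ s)))
... | p , p∈r , p∈s | inj₁ refl | inj₂ y₂≡ = below p p∈r p∈s (sym y₂≡)
... | p , p∈r , p∈s | inj₂ refl | inj₁ y₁≡ = above p p∈r p∈s (sym y₁≡)

classify-contact : ∀ {r s} → ShareSegment r s → InteriorsDisjoint r s → Contact r s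
classify-contact (inj₁ vertical)   r∩s=∅ = inj₂ (horizontal-contact vertical (flip r∩s=∅))
classify-contact (inj₂ horizontal) r∩s=∅ = inj₁ (horizontal-contact horizontal r∩s=∅)

horizontal-port : ∀ {r s} → HContact r s → Fin (width r) ⊎ Fin (width r)
horizontal-port (above _ p∈r _ _) = inj₁ (cell p∈r)
horizontal-port (below _ p∈r _ _) = inj₂ (cell p∈r)

horizontal-port-separates : ∀ {r s s′} → InteriorsDisjoint s s′ →
                  (t : HContact r s) (t′ : HContact r s′) → horizontal-port t ≢ horizontal-port t′
horizontal-port-separates {s = s} {s′} s∩s′=∅ (above p p∈r p∈s y₁≡) (above p′ p′∈r p′∈s′ y₁≡′) eq
  with cell-injective p∈r p′∈r (inj₁-injective eq)
... | refl = s∩s′=∅ (within⇒Overlap p∈s p′∈s′)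
                    (same-start⇒Overlap (trans y₁≡ (sym y₁≡′)) (y₁<y₂ s) (y₁<y₂ s′))
horizontal-port-separates {s = s} {s′} s∩s′=∅ (below p p∈r p∈s y₂≡) (below p′ p′∈r p′∈s′ y₂≡′) eq
  with cell-injective p∈r p′∈r (inj₂-injective eq)
... | refl = s∩s′=∅ (within⇒Overlap p∈s p′∈s′)
                    (same-end⇒Overlap (trans y₂≡ (sym y₂≡′)) (y₁<y₂ s) (y₁<y₂ s′))
horizontal-port-separates _ (above _ _ _ _) (below _ _ _ _) ()
horizontal-port-separates _ (below _ _ _ _) (above _ _ _ _) ()

port : ∀ {r s} → Contact r s → (Fin (width r) ⊎ Fin (width r)) ⊎ (Fin (height r) ⊎ Fin (height r))
port = Sum.map horizontal-port horizontal-port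

port-separates : ∀ {r s s′} → InteriorsDisjoint s s′ →
                 (t : Contact r s) (t′ : Contact r s′) → port t ≢ port t′
port-separates s∩s′=∅ (inj₁ t) (inj₁ t′) eq =
  horizontal-port-separates s∩s′=∅ t t′ (inj₁-injective eq)
port-separates s∩s′=∅ (inj₂ t) (inj₂ t′) eq =
  horizontal-port-separates (flip s∩s′=∅) t t′ (inj₂-injective eq)
port-separates _ (inj₁ _) (inj₂ _) ()
port-separates _ (inj₂ _) (inj₁ _) ()

join↣ : ∀ {m n} → (Fin m ⊎ Fin n) ↣ Fin (m ℕ.+ n)
join↣ = ↔⇒↣ (↔-sym +↔⊎)

perimeter-cells : ∀ {w h} → ((Fin w ⊎ Fin w) ⊎ (Fin h ⊎ Fin h)) ↣ Fin ((w ℕ.+ w) ℕ.+ (h ℕ.+ h))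
perimeter-cells = join↣ ↣-∘ (join↣ ⊎-↣ join↣)

perimeter-bound : ∀ {n} (r : Rect) (s : Fin n → Rect) →
  (∀ i → ShareSegment r (s i)) → (∀ i → InteriorsDisjoint r (s i)) →
  (∀ {i j} → i ≢ j → InteriorsDisjoint (s i) (s j)) →
  n ℕ.≤ (width r ℕ.+ width r) ℕ.+ (height r ℕ.+ height r)
perimeter-bound r s share r∩s=∅ s∩s=∅ = injective⇒≤ {f = to ∘ port ∘ contact-of} code-injective
  where
  open Injection perimeter-cells
  contact-of : ∀ i → Contact r (s i)
  contact-of i = classify-contact (share i) (r∩s=∅ i)
  code-injective : Injective _≡_ _≡_ (to ∘ port ∘ contact-of)
  code-injective {i} {j} eq with i ≟ j
  ... | yes i≡j = i≡j
  ... | no i≢j  = ⊥-elim (port-separates (s∩s=∅ i≢j) (contact-of i) (contact-of j) (injective eq))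

-- The vertices of S_n

-- A path lists the turns from the root (false = left).  heapᵣ reads it backwards, from the
-- node up to the root, and heap is the numbering of Defs: root 1, children 2i and 2i + 1.
heapᵣ : Path → ℕ
heapᵣ []          = 1
heapᵣ (false ∷ q) = 2 ℕ.* heapᵣ q
heapᵣ (true ∷ q)  = 2 ℕ.* heapᵣ q ℕ.+ 1

heap : Path → ℕ
heap = heapᵣ ∘ reverse

heapᵣ-positive : ∀ q → 1 ℕ.≤ heapᵣ q
heapᵣ-positive []          = s≤s z≤n
heapᵣ-positive (false ∷ q) = ℕₚ.≤-trans (heapᵣ-positive q) (ℕₚ.m≤m+n _ _)
heapᵣ-positive (true ∷ q)  =
  ℕₚ.≤-trans (heapᵣ-positive q) (ℕₚ.≤-trans (ℕₚ.m≤m+n _ _) (ℕₚ.m≤m+n _ 1))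

2≤heapᵣ-∷ : ∀ β q → 2 ℕ.≤ heapᵣ (β ∷ q)
2≤heapᵣ-∷ false q = ℕₚ.*-monoʳ-≤ 2 (heapᵣ-positive q)
2≤heapᵣ-∷ true  q = ℕₚ.≤-trans (2≤heapᵣ-∷ false q) (ℕₚ.m≤m+n _ 1)

heapᵣ<2^ : ∀ {k} q → length q ℕ.≤ k → heapᵣ q ℕ.< 2 ^ suc k
heapᵣ<2^ {k} [] _ = ℕₚ.*-monoʳ-≤ 2 (ℕₚ.m^n>0 2 k)
heapᵣ<2^ {suc k} (false ∷ q) (s≤s q≤k) = ℕₚ.*-monoʳ-< 2 (heapᵣ<2^ q q≤k)
heapᵣ<2^ {suc k} (true ∷ q)  (s≤s q≤k) = begin-strict
  2 ℕ.* heapᵣ q ℕ.+ 1  <⟨ ℕₚ.n<1+n _ ⟩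
  suc (2 ℕ.* heapᵣ q ℕ.+ 1) ≡⟨ cong suc (ℕₚ.+-comm _ 1) ⟩
  2 ℕ.+ 2 ℕ.* heapᵣ q  ≡⟨ ℕₚ.*-suc 2 (heapᵣ q) ⟨
  2 ℕ.* suc (heapᵣ q)  ≤⟨ ℕₚ.*-monoʳ-≤ 2 (heapᵣ<2^ q q≤k) ⟩
  2 ^ suc (suc k)      ∎
  where open ℕₚ.≤-Reasoning

heapᵣ-injective : Injective _≡_ _≡_ heapᵣ
heapᵣ-injective {[]}        {[]}         _  = refl
heapᵣ-injective {[]}        {β ∷ q}      eq = ⊥-elim (ℕₚ.<-irrefl eq (2≤heapᵣ-∷ β q))
heapᵣ-injective {β ∷ q}     {[]}         eq = ⊥-elim (ℕₚ.<-irrefl (sym eq) (2≤heapᵣ-∷ β q))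
heapᵣ-injective {false ∷ q} {false ∷ q′} eq =
  cong (false ∷_) (heapᵣ-injective (ℕₚ.*-cancelˡ-≡ (heapᵣ q) (heapᵣ q′) 2 eq))
heapᵣ-injective {true ∷ q}  {true ∷ q′}  eq =
  cong (true ∷_) (heapᵣ-injective (ℕₚ.*-cancelˡ-≡ (heapᵣ q) (heapᵣ q′) 2 (ℕₚ.+-cancelʳ-≡ 1 _ _ eq)))
heapᵣ-injective {false ∷ q} {true ∷ q′}  eq =
  ⊥-elim (ℕₚ.even≢odd (heapᵣ q) (heapᵣ q′) (trans eq (ℕₚ.+-comm _ 1)))
heapᵣ-injective {true ∷ q}  {false ∷ q′} eq =
  ⊥-elim (ℕₚ.even≢odd (heapᵣ q′) (heapᵣ q) (trans (sym eq) (ℕₚ.+-comm _ 1)))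

heap-injective : Injective _≡_ _≡_ heap
heap-injective = reverse-injective ∘ heapᵣ-injective

heap<2^ : ∀ {k} a → length a ℕ.≤ k → heap a ℕ.< 2 ^ suc k
heap<2^ {k} a a≤k = heapᵣ<2^ (reverse a) (subst (ℕ._≤ k) (sym (length-reverse a)) a≤k)

heap-∷ʳ : ∀ a β → heap (a ∷ʳ β) ≡ heapᵣ (β ∷ reverse a)
heap-∷ʳ a β = cong heapᵣ (reverse-++ a (β ∷ []))

tree-arc : ∀ {k} a β → length a ℕ.< k → Arc k (heap a) (heap (a ∷ʳ β))
tree-arc {k} a β a<k = subst (Arc k (heap a)) (sym (heap-∷ʳ a β)) (arc β)
  where
  child<2^ : ∀ β → heapᵣ (β ∷ reverse a) ℕ.< 2 ^ suc k
  child<2^ β = heapᵣ<2^ (β ∷ reverse a) (subst (ℕ._< k) (sym (length-reverse a)) a<k)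
  arc : ∀ β → Arc k (heap a) (heapᵣ (β ∷ reverse a))
  arc false = tree-left (heap a) (heapᵣ-positive (reverse a)) (child<2^ false)
  arc true  = tree-right (heap a) (heapᵣ-positive (reverse a)) (child<2^ true)

2^suc≤∣S∣ : ∀ k → 2 ^ suc k ℕ.≤ ∣S∣ k
2^suc≤∣S∣ k = ℕₚ.*-monoˡ-≤ (2 ^ k) (ℕₚ.n≤1+n 2)

leaf : ∀ k → Fin (2 ^ k) → ℕ
leaf k j = 2 ^ suc k ℕ.+ toℕ j

leaf-arc : ∀ k (j : Fin (2 ^ k)) → Arc k 0 (leaf k j)
leaf-arc k j = star (leaf k j) (ℕₚ.m≤m+n _ _)
  (ℕₚ.<-≤-trans (ℕₚ.+-monoʳ-< (2 ^ suc k) (toℕ<n j)) (ℕₚ.≤-reflexive (three (2 ^ k))))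
  where
  three : ∀ x → 2 ℕ.* x ℕ.+ x ≡ 3 ℕ.* x
  three = solve-∀

n<2*n : ∀ {n} → 1 ℕ.≤ n → n ℕ.< 2 ℕ.* n
n<2*n {n} 1≤n = ℕₚ.m<m+n n (ℕₚ.≤-trans 1≤n (ℕₚ.m≤m+n n 0))

arc-irreflexive : ∀ {k i j} → Arc k i j → i ≢ j
arc-irreflexive (tree-left _ 1≤i _)  eq = ℕₚ.<-irrefl eq (n<2*n 1≤i)
arc-irreflexive (tree-right _ 1≤i _) eq = ℕₚ.<-irrefl eq (ℕₚ.<-≤-trans (n<2*n 1≤i) (ℕₚ.m≤m+n _ 1))
arc-irreflexive root-centre ()
arc-irreflexive {k} (star _ 2^suc≤j _) eq =
  ℕₚ.<-irrefl eq (ℕₚ.<-≤-trans (ℕₚ.m^n>0 2 (suc k)) 2^suc≤j)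

arc-bounded : ∀ {k i j} → Arc k i j → i ℕ.< ∣S∣ k × j ℕ.< ∣S∣ k
arc-bounded {k} (tree-left i 1≤i 2i<) = ℕₚ.<-trans (n<2*n 1≤i) j<∣S∣ , j<∣S∣
  where j<∣S∣ = ℕₚ.<-≤-trans 2i< (2^suc≤∣S∣ k)
arc-bounded {k} (tree-right i 1≤i 2i+1<) =
  ℕₚ.<-trans (ℕₚ.<-≤-trans (n<2*n 1≤i) (ℕₚ.m≤m+n _ 1)) j<∣S∣ , j<∣S∣
  where j<∣S∣ = ℕₚ.<-≤-trans 2i+1< (2^suc≤∣S∣ k)
arc-bounded {k} root-centre = ℕₚ.<-trans (s≤s z≤n) 1<∣S∣ , 1<∣S∣
  where 1<∣S∣ = ℕₚ.<-≤-trans (ℕₚ.*-monoʳ-≤ 2 (ℕₚ.m^n>0 2 k)) (2^suc≤∣S∣ k)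
arc-bounded {k} (star j _ j<∣S∣) = ℕₚ.≤-<-trans z≤n j<∣S∣ , j<∣S∣

module _ {k} (L : RectLayout (∣S∣ k) (SAdj k)) where

  private instance
    ∣S∣-nonZero : NonZero (∣S∣ k)
    ∣S∣-nonZero = ℕ.>-nonZero (ℕₚ.<-≤-trans (ℕₚ.m^n>0 2 (suc k)) (2^suc≤∣S∣ k))

  -- Reducing mod ∣S∣ k only makes vertex total; it is the identity on vertex numbers.
  vertex : ℕ → Fin (∣S∣ k)
  vertex i = i mod ∣S∣ k

  toℕ-vertex : ∀ {i} → i ℕ.< ∣S∣ k → toℕ (vertex i) ≡ i
  toℕ-vertex i< = trans (toℕ-fromℕ< _) (m<n⇒m%n≡m i<)

  vertex-injective : ∀ {i j} → i ℕ.< ∣S∣ k → j ℕ.< ∣S∣ k → vertex i ≡ vertex j → i ≡ j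
  vertex-injective i< j< eq = trans (sym (toℕ-vertex i<)) (trans (cong toℕ eq) (toℕ-vertex j<))

  box : ℕ → Rect
  box i = rect L (vertex i)

  distinct⇒disjoint : ∀ {i j} → i ℕ.< ∣S∣ k → j ℕ.< ∣S∣ k → i ≢ j →
                      InteriorsDisjoint (box i) (box j)
  distinct⇒disjoint i< j< i≢j = disjoint L _ _ (i≢j ∘ vertex-injective i< j<)

  arc⇒ShareSegment : ∀ {i j} → Arc k i j → ShareSegment (box i) (box j)
  arc⇒ShareSegment arc with arc-bounded arc
  ... | i< , j< = Equivalence.from (contact L _ _ (arc-irreflexive arc ∘ vertex-injective i< j<))
    (inj₁ (subst₂ (Arc k) (sym (toℕ-vertex i<)) (sym (toℕ-vertex j<)) arc))

  arc⇒disjoint : ∀ {i j} → Arc k i j → InteriorsDisjoint (box i) (box j)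
  arc⇒disjoint arc with arc-bounded arc
  ... | i< , j< = distinct⇒disjoint i< j< (arc-irreflexive arc)

  tree-edges : EdgesXIntersect k (box ∘ heap)
  tree-edges = edges-x-intersect λ a β a<k →
    ShareSegment⇒XIntersect {box (heap a)} {box (heap (a ∷ʳ β))}
      (arc⇒ShareSegment (tree-arc a β a<k))

  tree-disjoint : ∀ {a a′} → length a ℕ.≤ k → length a′ ℕ.≤ k → a ≢ a′ →
                  InteriorsDisjoint (box (heap a)) (box (heap a′))
  tree-disjoint {a} {a′} a≤k a′≤k a≢a′ =
    distinct⇒disjoint (heap<∣S∣ a a≤k) (heap<∣S∣ a′ a′≤k) (a≢a′ ∘ heap-injective)
    where
    heap<∣S∣ : ∀ a → length a ℕ.≤ k → heap a ℕ.< ∣S∣ k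
    heap<∣S∣ a a≤k = ℕₚ.<-≤-trans (heap<2^ a a≤k) (2^suc≤∣S∣ k)

  tree-height : ∀ {X₁ X₂ Y₁ Y₂} → Encloses L X₁ X₂ Y₁ Y₂ → suc ⌊ k /2⌋ ℕ.≤ ∣ Y₁ - Y₂ ∣
  tree-height enclosed = stabbing-height (stabbing k tree-edges) tree-disjoint
    λ a _ → let (_ , _ , Y₁≤y₁ , y₂≤Y₂) = enclosed (vertex (heap a)) in Y₁≤y₁ , y₂≤Y₂

  centre : Rect
  centre = box 0

  star-perimeter : 2 ^ k ℕ.≤ (width centre ℕ.+ width centre) ℕ.+ (height centre ℕ.+ height centre)
  star-perimeter = perimeter-bound centre (box ∘ leaf k)
    (arc⇒ShareSegment ∘ leaf-arc k) (arc⇒disjoint ∘ leaf-arc k) leaves-disjoint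
    where
    leaves-disjoint : ∀ {i j} → i ≢ j → InteriorsDisjoint (box (leaf k i)) (box (leaf k j))
    leaves-disjoint {i} {j} i≢j = distinct⇒disjoint
      (proj₂ (arc-bounded (leaf-arc k i))) (proj₂ (arc-bounded (leaf-arc k j)))
      (i≢j ∘ toℕ-injective ∘ ℕₚ.+-cancelˡ-≡ (2 ^ suc k) _ _)

n≤2*suc⌊n/2⌋ : ∀ n → n ℕ.≤ 2 ℕ.* suc ⌊ n /2⌋
n≤2*suc⌊n/2⌋ zero          = z≤n
n≤2*suc⌊n/2⌋ (suc zero)    = s≤s z≤n
n≤2*suc⌊n/2⌋ (suc (suc n)) = subst (suc (suc n) ℕ.≤_) (sym (ℕₚ.*-suc 2 (suc ⌊ n /2⌋)))
  (s≤s (s≤s (n≤2*suc⌊n/2⌋ n)))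

perimeter*depth≤8*area : ∀ {n d W H M} → n ℕ.≤ (W ℕ.+ W) ℕ.+ (H ℕ.+ H) → d ℕ.≤ 2 ℕ.* M →
                         M ℕ.≤ W → M ℕ.≤ H → n ℕ.* d ℕ.≤ 8 ℕ.* (W ℕ.* H)
perimeter*depth≤8*area {n} {d} {W} {H} {M} n≤ d≤ M≤W M≤H = begin
  n ℕ.* d                                  ≤⟨ ℕₚ.*-mono-≤ n≤ d≤ ⟩
  ((W ℕ.+ W) ℕ.+ (H ℕ.+ H)) ℕ.* (2 ℕ.* M)  ≡⟨ expand W H M ⟩
  4 ℕ.* (W ℕ.* M) ℕ.+ 4 ℕ.* (H ℕ.* M)      ≤⟨ ℕₚ.+-mono-≤ (4*-mono (ℕₚ.*-monoʳ-≤ W M≤H))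
                                                              (4*-mono (ℕₚ.*-monoʳ-≤ H M≤W)) ⟩
  4 ℕ.* (W ℕ.* H) ℕ.+ 4 ℕ.* (H ℕ.* W)      ≡⟨ collect W H ⟩
  8 ℕ.* (W ℕ.* H)                          ∎
  where
  open ℕₚ.≤-Reasoning
  4*-mono : ∀ {x y} → x ℕ.≤ y → 4 ℕ.* x ℕ.≤ 4 ℕ.* y
  4*-mono = ℕₚ.*-monoʳ-≤ 4
  expand : ∀ W H M → ((W ℕ.+ W) ℕ.+ (H ℕ.+ H)) ℕ.* (2 ℕ.* M) ≡ 4 ℕ.* (W ℕ.* M) ℕ.+ 4 ℕ.* (H ℕ.* M)
  expand = solve-∀
  collect : ∀ W H → 4 ℕ.* (W ℕ.* H) ℕ.+ 4 ℕ.* (H ℕ.* W) ≡ 8 ℕ.* (W ℕ.* H)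
  collect = solve-∀

width≤ : ∀ {r lo hi} → lo ≤ x₁ r → x₂ r ≤ hi → width r ℕ.≤ ∣ lo - hi ∣
width≤ {r} lo≤x₁ x₂≤hi = ∣a-b∣≤∣lo-hi∣ lo≤x₁ (ℤₚ.<⇒≤ (x₁<x₂ r)) x₂≤hi

area-bound : ∀ {k X₁ X₂ Y₁ Y₂} (L : RectLayout (∣S∣ k) (SAdj k)) → Encloses L X₁ X₂ Y₁ Y₂ →
             + (2 ^ k ℕ.* k) ≤ + 8 * ((X₂ - X₁) * (Y₂ - Y₁))
area-bound {k} {X₁} {X₂} {Y₁} {Y₂} L enclosed with enclosed (vertex L 0)
... | X₁≤x₁ , x₂≤X₂ , Y₁≤y₁ , y₂≤Y₂ = begin
  + (2 ^ k ℕ.* k)         ≤⟨ +≤+ area ⟩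
  + (8 ℕ.* (W ℕ.* H))     ≡⟨ ℤₚ.pos-* 8 (W ℕ.* H) ⟩
  + 8 * + (W ℕ.* H)       ≡⟨ cong (+ 8 *_) (ℤₚ.pos-* W H) ⟩
  + 8 * (+ W * + H)       ≡⟨ cong₂ (λ u v → + 8 * (u * v)) (ℤₚ.∣-∣-≤ X₁≤X₂) (ℤₚ.∣-∣-≤ Y₁≤Y₂) ⟩
  + 8 * ((X₂ - X₁) * (Y₂ - Y₁)) ∎
  where
  open ℤₚ.≤-Reasoning
  C : Rect
  C = centre L
  W H : ℕ
  W = ∣ X₁ - X₂ ∣
  H = ∣ Y₁ - Y₂ ∣
  X₁≤X₂ : X₁ ≤ X₂
  X₁≤X₂ = ℤₚ.≤-trans X₁≤x₁ (ℤₚ.≤-trans (ℤₚ.<⇒≤ (x₁<x₂ C)) x₂≤X₂)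
  Y₁≤Y₂ : Y₁ ≤ Y₂
  Y₁≤Y₂ = ℤₚ.≤-trans Y₁≤y₁ (ℤₚ.≤-trans (ℤₚ.<⇒≤ (y₁<y₂ C)) y₂≤Y₂)
  perimeter : 2 ^ k ℕ.≤ (W ℕ.+ W) ℕ.+ (H ℕ.+ H)
  perimeter = ℕₚ.≤-trans (star-perimeter L)
    (ℕₚ.+-mono-≤ (ℕₚ.+-mono-≤ w≤W w≤W) (ℕₚ.+-mono-≤ h≤H h≤H))
    where
    w≤W : width C ℕ.≤ W
    w≤W = width≤ {C} X₁≤x₁ x₂≤X₂
    h≤H : height C ℕ.≤ H
    h≤H = width≤ {transpose C} Y₁≤y₁ y₂≤Y₂
  enclosedᵀ : Encloses (transpose-layout L) Y₁ Y₂ X₁ X₂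
  enclosedᵀ v = let (X₁≤ , ≤X₂ , Y₁≤ , ≤Y₂) = enclosed v in Y₁≤ , ≤Y₂ , X₁≤ , ≤X₂
  area : 2 ^ k ℕ.* k ℕ.≤ 8 ℕ.* (W ℕ.* H)
  area = perimeter*depth≤8*area perimeter (n≤2*suc⌊n/2⌋ k)
    (tree-height (transpose-layout L) enclosedᵀ) (tree-height L enclosed)

-- The bound holds for k = 0 as well.
theorem7 : Σ ℕ λ D → (D ≥ 1) ×
    (∀ (k : ℕ) → k ≥ 1 → (L : RectLayout (∣S∣ k) (SAdj k)) →
      ∀ (X₁ X₂ Y₁ Y₂ : ℤ) → Encloses L X₁ X₂ Y₁ Y₂ →
      + (2 ^ k Data.Nat.* k) ≤ + D * ((X₂ - X₁) * (Y₂ - Y₁)))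
theorem7 = 8 , s≤s z≤n , λ k _ L X₁ X₂ Y₁ Y₂ → area-bound L
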